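{- Let $T=(T,\eta,\mu)$ be a monad on a category $\mathbb C$, and let $f:A\rightsquigarrow B$ be a morphism of the Kleisli category $\mathsf{Kl}(T)$, with corresponding morphism $f^\sharp:A\to TB$ of $\mathbb C$. Then $f$ is thunkable if and only if $\eta_{TB}\circ f^\sharp=T(\eta_B)\circ f^\sharp$ as morphisms $A\to TTB$ (i.e. $f^\sharp$ forms a fork with the parallel pair $\eta_{TB},T\eta_B:TB\rightrightarrows TTB$).
   Context: The Kleisli category $\mathsf{Kl}(T)$ has the objects of $\mathbb C$; morphisms $f:A\rightsquigarrow B$ correspond bijectively to morphisms $f^\sharp:A\to TB$ of $\mathbb C$, with composition $(g\circledcirc f)^\sharp=\mu\circ T(g^\sharp)\circ f^\sharp$ and identities $(1_A)^\sharp=\eta_A$. $\mathsf{Kl}(T)$ carries a canonical comonad $L$: on objects $LA=TA$, on morphisms $(Lf)^\sharp=\eta_{TB}\circ\mu_B\circ T(f^\sharp)$ for $f:A\rightsquigarrow B$; and maps $\mathsf{thunk}_A:A\rightsquigarrow TA$ with $(\mathsf{thunk}_A)^\sharp=\eta_{TA}\circ\eta_A$, $\mathsf{force}_A:TA\rightsquigarrow A$ with $(\mathsf{force}_A)^\sharp=1_{TA}$. A Kleisli morphism $f:A\rightsquigarrow B$ is called thunkable if $\mathsf{thunk}_B\circledcirc f=Lf\circledcirc\mathsf{thunk}_A$. -}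

module Defs where

open import Level using (Level; suc; _⊔_)
open import Relation.Binary using (Rel; IsEquivalence)
open import Function.Bundles using (_⇔_)

record Category (o ℓ e : Level) : Set (suc (o ⊔ ℓ ⊔ e)) where
  infixr 9 _∘_
  infix 4 _≈_
  field
    Obj : Set o
    _⇒_ : Obj → Obj → Set ℓ
    _≈_ : ∀ {A B} → Rel (A ⇒ B) e
    id  : ∀ {A} → A ⇒ A
    _∘_ : ∀ {A B C} → B ⇒ C → A ⇒ B → A ⇒ C
    assoc     : ∀ {A B C D} {f : A ⇒ B} {g : B ⇒ C} {h : C ⇒ D} →
                (h ∘ g) ∘ f ≈ h ∘ (g ∘ f)
    identityˡ : ∀ {A B} {f : A ⇒ B} → id ∘ f ≈ f
    identityʳ : ∀ {A B} {f : A ⇒ B} → f ∘ id ≈ f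
    equiv     : ∀ {A B} → IsEquivalence (_≈_ {A} {B})
    ∘-resp-≈  : ∀ {A B C} {f h : B ⇒ C} {g i : A ⇒ B} →
                f ≈ h → g ≈ i → f ∘ g ≈ h ∘ i

record Monad {o ℓ e : Level} (C : Category o ℓ e) : Set (o ⊔ ℓ ⊔ e) where
  open Category C
  field
    T₀ : Obj → Obj
    T₁ : ∀ {A B} → A ⇒ B → T₀ A ⇒ T₀ B
    T-identity : ∀ {A} → T₁ (id {A}) ≈ id
    T-homomorphism : ∀ {A B C} {f : A ⇒ B} {g : B ⇒ C} →
                     T₁ (g ∘ f) ≈ T₁ g ∘ T₁ f
    T-resp-≈ : ∀ {A B} {f g : A ⇒ B} → f ≈ g → T₁ f ≈ T₁ g
    η : ∀ A → A ⇒ T₀ A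
    μ : ∀ A → T₀ (T₀ A) ⇒ T₀ A
    η-natural : ∀ {A B} {f : A ⇒ B} → η B ∘ f ≈ T₁ f ∘ η A
    μ-natural : ∀ {A B} {f : A ⇒ B} → μ B ∘ T₁ (T₁ f) ≈ T₁ f ∘ μ A
    μ-assoc   : ∀ {A} → μ A ∘ T₁ (μ A) ≈ μ A ∘ μ (T₀ A)
    μ-identityˡ : ∀ {A} → μ A ∘ T₁ (η A) ≈ id
    μ-identityʳ : ∀ {A} → μ A ∘ η (T₀ A) ≈ id

module Kleisli {o ℓ e : Level} {C : Category o ℓ e} (M : Monad C) where
  open Category C
  open Monad M

  record _⇝_ (A B : Obj) : Set ℓ where
    constructor kl
    field ♯ : A ⇒ T₀ B
  open _⇝_ public

  infix 4 _≈ₖ_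
  _≈ₖ_ : ∀ {A B} → A ⇝ B → A ⇝ B → Set e
  f ≈ₖ g = ♯ f ≈ ♯ g

  infixr 9 _⊚_
  _⊚_ : ∀ {A B C} → B ⇝ C → A ⇝ B → A ⇝ C
  g ⊚ f = kl (μ _ ∘ T₁ (♯ g) ∘ ♯ f)

  idₖ : ∀ {A} → A ⇝ A
  idₖ {A} = kl (η A)

  -- The canonical comonad L on Kl(T).
  L₀ : Obj → Obj
  L₀ = T₀

  L₁ : ∀ {A B} → A ⇝ B → L₀ A ⇝ L₀ B
  L₁ {A} {B} f = kl (η (T₀ B) ∘ μ B ∘ T₁ (♯ f))

  thunk : ∀ A → A ⇝ T₀ A
  thunk A = kl (η (T₀ A) ∘ η A)

  force : ∀ A → T₀ A ⇝ A
  force A = kl id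

  Thunkable : ∀ {A B} → A ⇝ B → Set e
  Thunkable {A} {B} f = thunk B ⊚ f ≈ₖ L₁ f ⊚ thunk A

-- Composing with the pure morphisms η ∘ h of Kl(T) is computed in C: on the
-- left it is T h, on the right it is precomposition with h. Hence
-- (thunk ⊚ f)♯ = T η ∘ f♯, while (L f ⊚ thunk)♯ = (L f)♯ ∘ η = η ∘ f♯ by the
-- unit laws, so thunkability is exactly the fork equation.
{-# OPTIONS --safe #-}
module Submission where

open import Defs
open import Level using (Level)
open import Function.Bundles using (_⇔_; mk⇔)
open import Relation.Binary using (Setoid; IsEquivalence)
import Relation.Binary.Reasoning.Setoid as SetoidReasoning

module CategoryProperties {o ℓ e : Level} (C : Category o ℓ e) where
  open Category C

  hom-setoid : Obj → Obj → Setoid ℓ e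
  hom-setoid X Y = record { Carrier = X ⇒ Y ; _≈_ = _≈_ ; isEquivalence = equiv }

  module _ {X Y : Obj} where
    open IsEquivalence (equiv {X} {Y}) public
      renaming (refl to ≈-refl; sym to ≈-sym; trans to ≈-trans)

  pullˡ : ∀ {W X Y Z} {h : Y ⇒ Z} {g : X ⇒ Y} {gh : X ⇒ Z} {k : W ⇒ X} →
          h ∘ g ≈ gh → h ∘ g ∘ k ≈ gh ∘ k
  pullˡ hg≈gh = ≈-trans (≈-sym assoc) (∘-resp-≈ hg≈gh ≈-refl)

  cancelˡ : ∀ {W X Y} {h : X ⇒ Y} {g : Y ⇒ X} {k : W ⇒ X} →
            g ∘ h ≈ id → g ∘ h ∘ k ≈ k
  cancelˡ gh≈id = ≈-trans (pullˡ gh≈id) identityˡ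

module KleisliProperties {o ℓ e : Level} {C : Category o ℓ e} (M : Monad C) where
  open Category C
  open Monad M
  open Kleisli M
  open CategoryProperties C

  ♯-pure-⊚ : ∀ {A B C} (h : B ⇒ C) (f : A ⇝ B) →
             ♯ (kl (η C ∘ h) ⊚ f) ≈ T₁ h ∘ ♯ f
  ♯-pure-⊚ {A} {B} {C} h f = begin
      μ C ∘ T₁ (η C ∘ h) ∘ ♯ f       ≈⟨ ∘-resp-≈ ≈-refl (∘-resp-≈ T-homomorphism ≈-refl) ⟩
      μ C ∘ (T₁ (η C) ∘ T₁ h) ∘ ♯ f  ≈⟨ ∘-resp-≈ ≈-refl assoc ⟩
      μ C ∘ T₁ (η C) ∘ T₁ h ∘ ♯ f    ≈⟨ cancelˡ μ-identityˡ ⟩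
      T₁ h ∘ ♯ f                     ∎
    where open SetoidReasoning (hom-setoid A (T₀ C))

  ♯-⊚-pure : ∀ {A B C} (g : B ⇝ C) (h : A ⇒ B) →
             ♯ (g ⊚ kl (η B ∘ h)) ≈ ♯ g ∘ h
  ♯-⊚-pure {A} {B} {C} g h = begin
      μ C ∘ T₁ (♯ g) ∘ η B ∘ h        ≈⟨ ∘-resp-≈ ≈-refl (pullˡ (≈-sym η-natural)) ⟩
      μ C ∘ (η (T₀ C) ∘ ♯ g) ∘ h      ≈⟨ ∘-resp-≈ ≈-refl assoc ⟩
      μ C ∘ η (T₀ C) ∘ ♯ g ∘ h        ≈⟨ cancelˡ μ-identityʳ ⟩
      ♯ g ∘ h                         ∎
    where open SetoidReasoning (hom-setoid A (T₀ C))

  ♯-L₁∘η : ∀ {A B} (f : A ⇝ B) → ♯ (L₁ f) ∘ η A ≈ η (T₀ B) ∘ ♯ f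
  ♯-L₁∘η {A} {B} f = begin
      (η (T₀ B) ∘ μ B ∘ T₁ (♯ f)) ∘ η A  ≈⟨ assoc ⟩
      η (T₀ B) ∘ (μ B ∘ T₁ (♯ f)) ∘ η A  ≈⟨ ∘-resp-≈ ≈-refl assoc ⟩
      η (T₀ B) ∘ μ B ∘ T₁ (♯ f) ∘ η A    ≈⟨ ∘-resp-≈ ≈-refl (∘-resp-≈ ≈-refl (≈-sym η-natural)) ⟩
      η (T₀ B) ∘ μ B ∘ η (T₀ B) ∘ ♯ f    ≈⟨ ∘-resp-≈ ≈-refl (cancelˡ μ-identityʳ) ⟩
      η (T₀ B) ∘ ♯ f                     ∎
    where open SetoidReasoning (hom-setoid A (T₀ (T₀ B)))

  ♯-thunk-⊚ : ∀ {A B} (f : A ⇝ B) → ♯ (thunk B ⊚ f) ≈ T₁ (η B) ∘ ♯ f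
  ♯-thunk-⊚ {B = B} = ♯-pure-⊚ (η B)

  ♯-L₁-⊚-thunk : ∀ {A B} (f : A ⇝ B) → ♯ (L₁ f ⊚ thunk A) ≈ η (T₀ B) ∘ ♯ f
  ♯-L₁-⊚-thunk {A} f = ≈-trans (♯-⊚-pure (L₁ f) (η A)) (♯-L₁∘η f)

  thunkable⇔fork : ∀ {A B} (f : A ⇝ B) →
                   Thunkable f ⇔ (η (T₀ B) ∘ ♯ f ≈ T₁ (η B) ∘ ♯ f)
  thunkable⇔fork f = mk⇔
    (λ thunkable → ≈-trans (≈-sym (♯-L₁-⊚-thunk f)) (≈-trans (≈-sym thunkable) (♯-thunk-⊚ f)))
    (λ fork → ≈-trans (♯-thunk-⊚ f) (≈-trans (≈-sym fork) (≈-sym (♯-L₁-⊚-thunk f))))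

proposition3p13 : {o ℓ e : Level} (C : Category o ℓ e) (M : Monad C) →
    let open Category C
        open Monad M
        open Kleisli M
    in ∀ {A B} (f : A ⇝ B) →
       Thunkable f ⇔ (η (T₀ B) ∘ ♯ f ≈ T₁ (η B) ∘ ♯ f)
proposition3p13 C M = KleisliProperties.thunkable⇔fork M
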